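{- $K_3\vee \text{antipaw}$ is $d_1$-choosable, where the antipaw is the graph on vertices $y_1,y_2,y_3,y_4$ with edge set $\{y_1y_2,\,y_1y_3\}$.
   Context: All graphs are finite and simple. A list assignment $L$ on $G$ assigns a finite set $L(v)\subseteq\mathbb{N}$ to each vertex; $G$ is $L$-colorable if there is a proper coloring $c$ with $c(v)\in L(v)$ for all $v$. For $f:V(G)\to\mathbb{N}$, $G$ is $f$-choosable if it is $L$-colorable for every $L$ with $|L(v)|=f(v)$ for all $v$. $G$ is $d_1$-choosable if it is $f$-choosable for $f(v)=d_G(v)-1$. $A\vee B$ is the join. -}

module Defs where

open import Data.Nat using (ℕ; _∸_)
open import Data.Bool using (Bool; true; false; T; not; _∧_; _∨_)
open import Data.Fin using (Fin; zero; suc; splitAt; _≟_)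
open import Data.Sum using (_⊎_; inj₁; inj₂)
open import Data.List using (List; length; filter; allFin)
open import Data.List.Membership.Propositional using (_∈_)
open import Data.List.Relation.Unary.Unique.Propositional using (Unique)
open import Relation.Binary.PropositionalEquality using (_≡_; _≢_; refl)
open import Relation.Nullary.Decidable using (T?; ⌊_⌋)
open import Relation.Nullary using (yes; no)
open import Data.Empty using (⊥-elim)
open import Data.Product using (Σ; _×_)
import Data.Nat

record Graph (n : ℕ) : Set where
  field
    adj    : Fin n → Fin n → Bool
    adj-sym    : ∀ u v → adj u v ≡ adj v u
    adj-irrefl : ∀ v → adj v v ≡ false
open Graph public

deg : ∀ {n} → Graph n → Fin n → ℕ
deg G v = length (filter (λ u → T? (adj G v u)) (allFin _))

record ListAssignment {n : ℕ} (f : Fin n → ℕ) : Set where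
  field
    lists  : Fin n → List ℕ
    unique : ∀ v → Unique (lists v)
    size   : ∀ v → length (lists v) ≡ f v
open ListAssignment public

Colorable : ∀ {n} → Graph n → (Fin n → List ℕ) → Set
Colorable {n} G L =
  Σ (Fin n → ℕ) λ c →
    ((v : Fin n) → c v ∈ L v) ×
    ((u v : Fin n) → adj G u v ≡ true → c u ≢ c v)

Choosable : ∀ {n} → Graph n → (Fin n → ℕ) → Set
Choosable G f = (L : ListAssignment f) → Colorable G (lists L)

-- d₁-choosable: f(v) = d_G(v) - 1 (truncated subtraction; in the graph
-- of interest every degree is ≥ 3, so no truncation occurs).
D1Choosable : ∀ {n} → Graph n → Set
D1Choosable G = Choosable G (λ v → deg G v ∸ 1)

-- Join of graphs A (on Fin m) and B (on Fin k), on Fin (m + k):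
-- first m vertices are A's, the rest B's; all A–B pairs adjacent.
joinAdj : ∀ {m k} → Graph m → Graph k → Fin (m Data.Nat.+ k) → Fin (m Data.Nat.+ k) → Bool
joinAdj {m} A B x y with splitAt m x | splitAt m y
... | inj₁ a | inj₁ a' = adj A a a'
... | inj₂ b | inj₂ b' = adj B b b'
... | inj₁ _ | inj₂ _ = true
... | inj₂ _ | inj₁ _ = true

joinSym : ∀ {m k} (A : Graph m) (B : Graph k) x y → joinAdj A B x y ≡ joinAdj A B y x
joinSym {m} A B x y with splitAt m x | splitAt m y
... | inj₁ a | inj₁ a' = Graph.adj-sym A a a'
... | inj₂ b | inj₂ b' = Graph.adj-sym B b b'
... | inj₁ _ | inj₂ _ = refl
... | inj₂ _ | inj₁ _ = refl

joinIrrefl : ∀ {m k} (A : Graph m) (B : Graph k) x → joinAdj A B x x ≡ false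
joinIrrefl {m} A B x with splitAt m x
... | inj₁ a = Graph.adj-irrefl A a
... | inj₂ b = Graph.adj-irrefl B b

_∨ᴳ_ : ∀ {m k} → Graph m → Graph k → Graph (m Data.Nat.+ k)
A ∨ᴳ B = record { adj = joinAdj A B ; adj-sym = joinSym A B ; adj-irrefl = joinIrrefl A B }

K : (n : ℕ) → Graph n
K n = record { adj = λ u v → not ⌊ u ≟ v ⌋ ; adj-sym = s ; adj-irrefl = i }
  where
  s : ∀ u v → not ⌊ u ≟ v ⌋ ≡ not ⌊ v ≟ u ⌋
  s u v with u ≟ v | v ≟ u
  ... | yes _ | yes _ = refl
  ... | no _  | no _  = refl
  ... | yes p | no q  = ⊥-elim (q (Relation.Binary.PropositionalEquality.sym p))
  ... | no q  | yes p = ⊥-elim (q (Relation.Binary.PropositionalEquality.sym p))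
  i : ∀ v → not ⌊ v ≟ v ⌋ ≡ false
  i v with v ≟ v
  ... | yes _ = refl
  ... | no q = ⊥-elim (q refl)

-- Antipaw on y₁,y₂,y₃,y₄ = Fin 4 indices 0,1,2,3; edges y₁y₂, y₁y₃.
antipawAdj : Fin 4 → Fin 4 → Bool
antipawAdj zero (suc zero) = true
antipawAdj zero (suc (suc zero)) = true
antipawAdj (suc zero) zero = true
antipawAdj (suc (suc zero)) zero = true
antipawAdj _ _ = false

antipaw : Graph 4
antipaw = record { adj = antipawAdj ; adj-sym = s ; adj-irrefl = i }
  where
  s : ∀ u v → antipawAdj u v ≡ antipawAdj v u
  s zero zero = refl
  s zero (suc zero) = refl
  s zero (suc (suc zero)) = refl
  s zero (suc (suc (suc zero))) = refl
  s (suc zero) zero = refl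
  s (suc zero) (suc zero) = refl
  s (suc zero) (suc (suc zero)) = refl
  s (suc zero) (suc (suc (suc zero))) = refl
  s (suc (suc zero)) zero = refl
  s (suc (suc zero)) (suc zero) = refl
  s (suc (suc zero)) (suc (suc zero)) = refl
  s (suc (suc zero)) (suc (suc (suc zero))) = refl
  s (suc (suc (suc zero))) zero = refl
  s (suc (suc (suc zero))) (suc zero) = refl
  s (suc (suc (suc zero))) (suc (suc zero)) = refl
  s (suc (suc (suc zero))) (suc (suc (suc zero))) = refl
  i : ∀ v → antipawAdj v v ≡ false
  i zero = refl
  i (suc zero) = refl
  i (suc (suc zero)) = refl
  i (suc (suc (suc zero))) = refl

-- The degrees make the lists M₁, M₂, M₃ on the triangle x₁x₂x₃ have 5 colours and the lists L₁, …,
-- L₄ on the antipaw y₁y₂y₃y₄ have 4, 3, 3, 2 colours. Colour the antipaw first, with colour set Y,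
-- and then the triangle greedily (x₃, then x₂, then x₁): this succeeds as soon as, in some order,
-- the three triangle lists contain at most 2, 3 and 4 colours of Y. Reusing a colour (y₂ = y₃, y₁ = y₄ or y₂ = y₄)
-- gives |Y| ≤ 3, and since a union of disjoint lists with at least 6 colours is not inside a
-- 5-colour list, the free choices can put one colour of Y outside some Mᵢ. When L₄ is disjoint from
-- the other lists (or two triangle lists both equal {d} ∪ L₁), |Y| = 4 and the same counting puts
-- two colours of Y outside one Mᵢ and one outside another Mⱼ.

module Submission where

open import Defs
open import Data.Nat using (ℕ; suc; _+_; _∸_; _≤_; _<_; z≤n; s≤s; z<s; s<s)
open import Data.Nat.Properties using (_≟_; ≤-refl; m≤n⇒m≤1+n; ≤-reflexive; ≤-pred; <⇒≱; module ≤-Reasoning)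
open import Data.Fin using (Fin; splitAt; _↑ˡ_; _↑ʳ_)
open import Data.Fin.Patterns using (0F; 1F; 2F; 3F; 4F; 5F; 6F)
open import Data.Fin.Properties using (splitAt⁻¹-↑ˡ; splitAt⁻¹-↑ʳ)
open import Data.List using (List; []; _∷_; length; _++_)
open import Data.List.Properties using (length-++; length-removeAt′)
open import Data.List.Membership.Propositional using (_∈_; _∉_; find; lose)
open import Data.List.Membership.Propositional.Properties using (∈-++⁻)
open import Data.List.Membership.DecPropositional _≟_ using (_∈?_)
open import Data.List.Relation.Unary.Any using (Any; here; there; index; _─_; any?)
open import Data.List.Relation.Unary.All as All using (All; []; _∷_; all?)
open import Data.List.Relation.Unary.All.Properties using (¬Any⇒All¬; ¬All⇒Any¬)
open import Data.List.Relation.Unary.AllPairs using (_∷_)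
open import Data.List.Relation.Unary.Unique.Propositional using (Unique)
open import Data.List.Relation.Unary.Unique.Propositional.Properties using (++⁺)
open import Data.List.Relation.Binary.Subset.Propositional using (_⊆_)
open import Data.List.Relation.Binary.Disjoint.Propositional using (Disjoint)
open import Data.List.Relation.Binary.Disjoint.Propositional.Properties using () renaming (sym to Disjoint-sym)
open import Data.Product using (Σ; ∃-syntax; _×_; _,_)
open import Data.Sum using (_⊎_; inj₁; inj₂; [_,_]′)
open import Data.Empty using (⊥-elim)
open import Data.Bool using (true)
open import Function using (_∘_)
open import Relation.Binary.PropositionalEquality using (_≡_; _≢_; refl; sym; trans; cong; cong₂; subst; ≢-sym)
open import Relation.Nullary using (¬_; yes; no)

∈-─ : ∀ {P : ℕ → Set} {y xs} (p : Any P xs) → y ∈ xs → ¬ P y → y ∈ (xs ─ p)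
∈-─ (here px) (here refl) ¬py = ⊥-elim (¬py px)
∈-─ (here _)  (there y∈)  _   = y∈
∈-─ (there _) (here refl) _   = here refl
∈-─ (there p) (there y∈)  ¬py = there (∈-─ p y∈ ¬py)

⊆⇒length≤ : ∀ {xs ys : List ℕ} → Unique xs → xs ⊆ ys → length xs ≤ length ys
⊆⇒length≤ {[]}     _               _     = z≤n
⊆⇒length≤ {x ∷ xs} {ys} (x∉xs ∷ uxs) xs⊆ys = begin
  suc (length xs)          ≤⟨ s≤s (⊆⇒length≤ uxs xs⊆ys─x) ⟩
  suc (length (ys ─ x∈ys)) ≡⟨ sym (length-removeAt′ ys (index x∈ys)) ⟩
  length ys                ∎
  where
  open ≤-Reasoning
  x∈ys = xs⊆ys (here refl)
  xs⊆ys─x : xs ⊆ (ys ─ x∈ys)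
  xs⊆ys─x y∈xs = ∈-─ x∈ys (xs⊆ys (there y∈xs)) (λ x≡y → All.lookup x∉xs y∈xs x≡y)

outside-or-⊆ : (K F : List ℕ) → (∃[ k ] k ∈ K × k ∉ F) ⊎ K ⊆ F
outside-or-⊆ K F with all? (_∈? F) K
... | yes K⊆F = inj₂ (All.lookup K⊆F)
... | no  K⊈F = inj₁ (find (¬All⇒Any¬ (_∈? F) K K⊈F))

common-or-disjoint : (A B : List ℕ) → (∃[ k ] k ∈ A × k ∈ B) ⊎ Disjoint A B
common-or-disjoint A B with any? (_∈? B) A
... | yes A∩B = inj₁ (find A∩B)
... | no  A∩B=∅ = inj₂ (λ (a∈A , a∈B) → A∩B=∅ (lose a∈A a∈B))

disjoint⇒≢ : ∀ {A B : List ℕ} {a b} → Disjoint A B → a ∈ A → b ∈ B → a ≢ b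
disjoint⇒≢ A∩B=∅ a∈A b∈B refl = A∩B=∅ (a∈A , b∈B)

disjoint⇒∉ : ∀ {A B : List ℕ} {b} → Disjoint A B → b ∈ B → b ∉ A
disjoint⇒∉ A∩B=∅ b∈B b∈A = A∩B=∅ (b∈A , b∈B)

disjoint-++⁺ : ∀ {A B C : List ℕ} → Disjoint A B → Disjoint A C → Disjoint A (B ++ C)
disjoint-++⁺ {B = B} A∩B=∅ A∩C=∅ (x∈A , x∈B++C) with ∈-++⁻ B x∈B++C
... | inj₁ x∈B = A∩B=∅ (x∈A , x∈B)
... | inj₂ x∈C = A∩C=∅ (x∈A , x∈C)

∈-∉⇒≢ : ∀ {M : List ℕ} {a b} → a ∈ M → b ∉ M → a ≢ b
∈-∉⇒≢ a∈M b∉M refl = b∉M a∈M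

record Palette (n : ℕ) (L : List ℕ) : Set where
  field
    distinct : Unique L
    size     : length L ≡ n
open Palette

pick : ∀ {n K} {F : List ℕ} → Palette n K → length F < n → ∃[ k ] k ∈ K × k ∉ F
pick {K = K} {F} pK |F|<n with outside-or-⊆ K F
... | inj₁ k = k
... | inj₂ K⊆F = ⊥-elim (<⇒≱ (subst (length F <_) (sym (size pK)) |F|<n) (⊆⇒length≤ (distinct pK) K⊆F))

pick-outside : ∀ {m n K M} → Palette n K → Palette m M → m < n → ∃[ k ] k ∈ K × k ∉ M
pick-outside pK pM m<n = pick pK (subst (_< _) (sym (size pM)) m<n)

element : ∀ {n K} → Palette (suc n) K → ∃[ k ] k ∈ K
element pK with k , k∈K , _ ← pick {F = []} pK z<s = k , k∈K

avoiding : ∀ {n K} (a : ℕ) → Palette (suc (suc n)) K → ∃[ k ] k ∈ K × k ≢ a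
avoiding a pK with k , k∈K , k∉ ← pick {F = a ∷ []} pK (s<s z<s) = k , k∈K , k∉ ∘ here

avoiding₂ : ∀ {n K} (a b : ℕ) → Palette (suc (suc (suc n))) K → ∃[ k ] k ∈ K × k ≢ a × k ≢ b
avoiding₂ a b pK with k , k∈K , k∉ ← pick {F = a ∷ b ∷ []} pK (s<s (s<s z<s)) =
  k , k∈K , k∉ ∘ here , k∉ ∘ there ∘ here

palette-∷ : ∀ {n x L} → x ∉ L → Palette n L → Palette (suc n) (x ∷ L)
palette-∷ {L = L} x∉L pL = record { distinct = ¬Any⇒All¬ L x∉L ∷ distinct pL ; size = cong suc (size pL) }

palette-++ : ∀ {m n A B} → Disjoint A B → Palette m A → Palette n B → Palette (m + n) (A ++ B)
palette-++ {A = A} A∩B=∅ pA pB = record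
  { distinct = ++⁺ (distinct pA) (distinct pB) A∩B=∅
  ; size     = trans (length-++ A) (cong₂ _+_ (size pA) (size pB)) }

⊆⇒⊇ : ∀ {n K M} → Palette n K → Palette n M → K ⊆ M → M ⊆ K
⊆⇒⊇ {K = K} pK pM K⊆M {x} x∈M with x ∈? K
... | yes x∈K = x∈K
... | no  x∉K with pick-outside (palette-∷ x∉K pK) pM ≤-refl
...   | _ , here refl , x∉M = ⊥-elim (x∉M x∈M)
...   | _ , there k∈K , k∉M = ⊥-elim (k∉M (K⊆M k∈K))

⊆⇒⊆-∷ : ∀ {n L M} → Palette n L → Palette (suc n) M → L ⊆ M → ∃[ z ] M ⊆ z ∷ L
⊆⇒⊆-∷ pL pM L⊆M with z , z∈M , z∉L ← pick-outside pM pL ≤-refl =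
  z , ⊆⇒⊇ (palette-∷ z∉L pL) pM λ { (here refl) → z∈M ; (there y∈L) → L⊆M y∈L }

-- Every colour of Y available in M occurs in F, so at most length F colours of Y lie in M.
_∩_⊆_ : List ℕ → List ℕ → List ℕ → Set
Y ∩ M ⊆ F = All (λ y → y ∈ M → y ∈ F) Y

∩⊆⇒∉ : ∀ {Y M F x} → Y ∩ M ⊆ F → x ∈ M → x ∉ F → x ∉ Y
∩⊆⇒∉ Y∩M⊆F x∈M x∉F x∈Y = x∉F (All.lookup Y∩M⊆F x∈Y x∈M)

All∈⇒∩⊆ : ∀ {Y M T} → All (_∈ T) Y → Y ∩ M ⊆ T
All∈⇒∩⊆ = All.map λ y∈T _ → y∈T

∩⊆-─ : ∀ {Y M F} (p : Any (_∉ M) F) → Y ∩ M ⊆ F → Y ∩ M ⊆ (F ─ p)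
∩⊆-─ p = All.map λ y∈M→y∈F y∈M → ∈-─ p (y∈M→y∈F y∈M) (λ y∉M → y∉M y∈M)

record TriangleColouring (M₁ M₂ M₃ Y : List ℕ) : Set where
  constructor triangleColouring
  field
    {x₁ x₂ x₃} : ℕ
    x₁∈ : x₁ ∈ M₁
    x₂∈ : x₂ ∈ M₂
    x₃∈ : x₃ ∈ M₃
    x₁≢x₂ : x₁ ≢ x₂
    x₁≢x₃ : x₁ ≢ x₃
    x₂≢x₃ : x₂ ≢ x₃
    x₁∉ : x₁ ∉ Y
    x₂∉ : x₂ ∉ Y
    x₃∉ : x₃ ∉ Y

swap₁₂ : ∀ {M₁ M₂ M₃ Y} → TriangleColouring M₁ M₂ M₃ Y → TriangleColouring M₂ M₁ M₃ Y
swap₁₂ (triangleColouring x₁∈ x₂∈ x₃∈ x₁≢x₂ x₁≢x₃ x₂≢x₃ x₁∉ x₂∉ x₃∉) =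
  triangleColouring x₂∈ x₁∈ x₃∈ (≢-sym x₁≢x₂) x₂≢x₃ x₁≢x₃ x₂∉ x₁∉ x₃∉

swap₂₃ : ∀ {M₁ M₂ M₃ Y} → TriangleColouring M₁ M₂ M₃ Y → TriangleColouring M₁ M₃ M₂ Y
swap₂₃ (triangleColouring x₁∈ x₂∈ x₃∈ x₁≢x₂ x₁≢x₃ x₂≢x₃ x₁∉ x₂∉ x₃∉) =
  triangleColouring x₁∈ x₃∈ x₂∈ x₁≢x₃ x₁≢x₂ (≢-sym x₂≢x₃) x₁∉ x₃∉ x₂∉

triangle-⊆ : ∀ {M₁ M₂ M₃ Y Y′} → Y′ ⊆ Y → TriangleColouring M₁ M₂ M₃ Y → TriangleColouring M₁ M₂ M₃ Y′
triangle-⊆ Y′⊆Y (triangleColouring x₁∈ x₂∈ x₃∈ x₁≢x₂ x₁≢x₃ x₂≢x₃ x₁∉ x₂∉ x₃∉) =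
  triangleColouring x₁∈ x₂∈ x₃∈ x₁≢x₂ x₁≢x₃ x₂≢x₃ (x₁∉ ∘ Y′⊆Y) (x₂∉ ∘ Y′⊆Y) (x₃∉ ∘ Y′⊆Y)

module Greedy {M₁ M₂ M₃ : List ℕ} (pM₁ : Palette 5 M₁) (pM₂ : Palette 5 M₂) (pM₃ : Palette 5 M₃) where

  greedy : ∀ {Y F₁ F₂ F₃} → Y ∩ M₁ ⊆ F₁ → Y ∩ M₂ ⊆ F₂ → Y ∩ M₃ ⊆ F₃ →
           length F₁ ≤ 2 → length F₂ ≤ 3 → length F₃ ≤ 4 → TriangleColouring M₁ M₂ M₃ Y
  greedy {F₁ = F₁} {F₂} c₁ c₂ c₃ l₁ l₂ l₃
    with x₃ , x₃∈ , x₃∉ ← pick pM₃ (s≤s l₃)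
    with x₂ , x₂∈ , x₂∉ ← pick {F = x₃ ∷ F₂} pM₂ (s≤s (s≤s l₂))
    with x₁ , x₁∈ , x₁∉ ← pick {F = x₂ ∷ x₃ ∷ F₁} pM₁ (s≤s (s≤s (s≤s l₁))) =
    triangleColouring x₁∈ x₂∈ x₃∈ (x₁∉ ∘ here) (x₁∉ ∘ there ∘ here) (x₂∉ ∘ here)
      (∩⊆⇒∉ c₁ x₁∈ (x₁∉ ∘ there ∘ there)) (∩⊆⇒∉ c₂ x₂∈ (x₂∉ ∘ there)) (∩⊆⇒∉ c₃ x₃∈ x₃∉)

  complete₂ : ∀ {Y a b} → All (_∈ a ∷ b ∷ []) Y → TriangleColouring M₁ M₂ M₃ Y
  complete₂ Y⊆T =
    greedy (All∈⇒∩⊆ Y⊆T) (All∈⇒∩⊆ Y⊆T) (All∈⇒∩⊆ Y⊆T) (s≤s (s≤s z≤n)) (s≤s (s≤s z≤n)) (s≤s (s≤s z≤n))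

  complete₃ : ∀ {Y a b c} → All (_∈ a ∷ b ∷ c ∷ []) Y → a ∉ M₁ → TriangleColouring M₁ M₂ M₃ Y
  complete₃ Y⊆T a∉M₁ =
    greedy (∩⊆-─ (here a∉M₁) (All∈⇒∩⊆ Y⊆T)) (All∈⇒∩⊆ Y⊆T) (All∈⇒∩⊆ Y⊆T)
      (s≤s (s≤s z≤n)) (s≤s (s≤s (s≤s z≤n))) (s≤s (s≤s (s≤s z≤n)))

  complete₄ : ∀ {Y a b c d} → All (_∈ a ∷ b ∷ c ∷ d ∷ []) Y → a ∉ M₁ → b ∉ M₁ →
              Any (_∉ M₂) (a ∷ b ∷ c ∷ d ∷ []) → TriangleColouring M₁ M₂ M₃ Y
  complete₄ {a = a} {b} {c} {d} Y⊆T a∉M₁ b∉M₁ p =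
    greedy (∩⊆-─ (here b∉M₁) (∩⊆-─ (here a∉M₁) (All∈⇒∩⊆ Y⊆T))) (∩⊆-─ p (All∈⇒∩⊆ Y⊆T)) (All∈⇒∩⊆ Y⊆T)
      (s≤s (s≤s z≤n)) (≤-pred (≤-reflexive (sym (length-removeAt′ (a ∷ b ∷ c ∷ d ∷ []) (index p)))))
      (s≤s (s≤s (s≤s (s≤s z≤n))))

record AntipawColouring (L₁ L₂ L₃ L₄ : List ℕ) : Set where
  constructor antipawColouring
  field
    {y₁ y₂ y₃ y₄} : ℕ
    y₁∈ : y₁ ∈ L₁
    y₂∈ : y₂ ∈ L₂
    y₃∈ : y₃ ∈ L₃
    y₄∈ : y₄ ∈ L₄
    y₁≢y₂ : y₁ ≢ y₂
    y₁≢y₃ : y₁ ≢ y₃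

  colours : List ℕ
  colours = y₁ ∷ y₂ ∷ y₃ ∷ y₄ ∷ []

Solution : (M₁ M₂ M₃ L₁ L₂ L₃ L₄ : List ℕ) → Set
Solution M₁ M₂ M₃ L₁ L₂ L₃ L₄ =
  Σ (AntipawColouring L₁ L₂ L₃ L₄) λ ys → TriangleColouring M₁ M₂ M₃ (AntipawColouring.colours ys)

record Assignment (M₁ M₂ M₃ L₁ L₂ L₃ L₄ : List ℕ) : Set where
  constructor assignment
  field
    pM₁ : Palette 5 M₁
    pM₂ : Palette 5 M₂
    pM₃ : Palette 5 M₃
    pL₁ : Palette 4 L₁
    pL₂ : Palette 3 L₂
    pL₃ : Palette 3 L₃
    pL₄ : Palette 2 L₄

module _ {M₁ M₂ M₃ L₁ L₂ L₃ L₄ : List ℕ} where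

  swapM₁₂ : Assignment M₁ M₂ M₃ L₁ L₂ L₃ L₄ → Assignment M₂ M₁ M₃ L₁ L₂ L₃ L₄
  swapM₁₂ (assignment pM₁ pM₂ pM₃ pL₁ pL₂ pL₃ pL₄) = assignment pM₂ pM₁ pM₃ pL₁ pL₂ pL₃ pL₄

  swapM₂₃ : Assignment M₁ M₂ M₃ L₁ L₂ L₃ L₄ → Assignment M₁ M₃ M₂ L₁ L₂ L₃ L₄
  swapM₂₃ (assignment pM₁ pM₂ pM₃ pL₁ pL₂ pL₃ pL₄) = assignment pM₁ pM₃ pM₂ pL₁ pL₂ pL₃ pL₄

  swapL₂₃ : Assignment M₁ M₂ M₃ L₁ L₂ L₃ L₄ → Assignment M₁ M₂ M₃ L₁ L₃ L₂ L₄
  swapL₂₃ (assignment pM₁ pM₂ pM₃ pL₁ pL₂ pL₃ pL₄) = assignment pM₁ pM₂ pM₃ pL₁ pL₃ pL₂ pL₄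

  solution-swapM₁₂ : Solution M₂ M₁ M₃ L₁ L₂ L₃ L₄ → Solution M₁ M₂ M₃ L₁ L₂ L₃ L₄
  solution-swapM₁₂ (ys , xs) = ys , swap₁₂ xs

  solution-swapM₂₃ : Solution M₁ M₃ M₂ L₁ L₂ L₃ L₄ → Solution M₁ M₂ M₃ L₁ L₂ L₃ L₄
  solution-swapM₂₃ (ys , xs) = ys , swap₂₃ xs

  solution-swapL₂₃ : Solution M₁ M₂ M₃ L₁ L₃ L₂ L₄ → Solution M₁ M₂ M₃ L₁ L₂ L₃ L₄
  solution-swapL₂₃ (antipawColouring y₁∈ y₃∈ y₂∈ y₄∈ y₁≢y₃ y₁≢y₂ , xs) =
    antipawColouring y₁∈ y₂∈ y₃∈ y₄∈ y₁≢y₂ y₁≢y₃ , triangle-⊆ swap-middle xs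
    where
    swap-middle : ∀ {a b c d x : ℕ} → x ∈ a ∷ b ∷ c ∷ d ∷ [] → x ∈ a ∷ c ∷ b ∷ d ∷ []
    swap-middle (here x≡a)                 = here x≡a
    swap-middle (there (here x≡b))         = there (there (here x≡b))
    swap-middle (there (there (here x≡c))) = there (here x≡c)
    swap-middle (there (there (there x∈))) = there (there (there x∈))

pattern #0 = here refl
pattern #1 = there #0
pattern #2 = there #1
pattern #3 = there #2

⊆-∷⇒≡ : ∀ {M L : List ℕ} {z y} → M ⊆ z ∷ L → y ∉ L → y ∈ M → y ≡ z
⊆-∷⇒≡ M⊆z∷L y∉L y∈M with M⊆z∷L y∈M
... | here y≡z = y≡z
... | there y∈L = ⊥-elim (y∉L y∈L)

one-of-two-∉ : ∀ {M L : List ℕ} {z a b} → M ⊆ z ∷ L → a ≢ b → a ∉ L → b ∉ L → a ∉ M ⊎ b ∉ M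
one-of-two-∉ {z = z} {a} M⊆z∷L a≢b a∉L b∉L with a ≟ z
... | yes refl = inj₂ λ b∈M → a≢b (sym (⊆-∷⇒≡ M⊆z∷L b∉L b∈M))
... | no  a≢z  = inj₁ λ a∈M → a≢z (⊆-∷⇒≡ M⊆z∷L a∉L a∈M)

pick-∉-of-two : ∀ {M L K : List ℕ} {z a b} → M ⊆ z ∷ L → a ∈ K → b ∈ K → a ≢ b → a ∉ L → b ∉ L →
                ∃[ v ] v ∈ K × v ∉ L × v ∉ M
pick-∉-of-two M⊆z∷L a∈K b∈K a≢b a∉L b∉L with one-of-two-∉ M⊆z∷L a≢b a∉L b∉L
... | inj₁ a∉M = _ , a∈K , a∉L , a∉M
... | inj₂ b∉M = _ , b∈K , b∉L , b∉M

-- Case names: `meet-Lᵢ…` colours the named vertices with a common colour of their lists, `apart`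
-- means disjoint lists, `missing-Mᵢ` provides a colour of Y outside Mᵢ, `inside-L₁` means L₁ ⊆ Mᵢ.
module _ {M₁ M₂ M₃ L₁ L₂ L₃ L₄ : List ℕ} (h : Assignment M₁ M₂ M₃ L₁ L₂ L₃ L₄) where
  open Assignment h
  open Greedy pM₁ pM₂ pM₃

  meet-L₂L₃L₄ : ∀ {c} → c ∈ L₂ → c ∈ L₃ → c ∈ L₄ → Solution M₁ M₂ M₃ L₁ L₂ L₃ L₄
  meet-L₂L₃L₄ {c} c∈L₂ c∈L₃ c∈L₄ with y₁ , y₁∈ , y₁≢c ← avoiding c pL₁ =
    antipawColouring y₁∈ c∈L₂ c∈L₃ c∈L₄ y₁≢c y₁≢c , complete₂ (#1 ∷ #0 ∷ #0 ∷ #0 ∷ [])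

  meet-L₂L₃-meet-L₁L₄ : ∀ {c d} → c ∈ L₂ → c ∈ L₃ → c ∉ L₄ → d ∈ L₁ → d ∈ L₄ →
                        Solution M₁ M₂ M₃ L₁ L₂ L₃ L₄
  meet-L₂L₃-meet-L₁L₄ c∈L₂ c∈L₃ c∉L₄ d∈L₁ d∈L₄ =
    antipawColouring d∈L₁ c∈L₂ c∈L₃ d∈L₄ d≢c d≢c , complete₂ (#0 ∷ #1 ∷ #1 ∷ #0 ∷ [])
    where d≢c = ∈-∉⇒≢ d∈L₄ c∉L₄

  meet-L₂L₃-apart-L₁L₄ : ∀ {c} → c ∈ L₂ → c ∈ L₃ → Disjoint L₁ L₄ → Solution M₁ M₂ M₃ L₁ L₂ L₃ L₄
  meet-L₂L₃-apart-L₁L₄ {c} c∈L₂ c∈L₃ L₁∩L₄=∅ with c ∈? M₁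
  ... | no c∉M₁ with y₁ , y₁∈ , y₁≢c ← avoiding c pL₁ | y₄ , y₄∈ ← element pL₄ =
    antipawColouring y₁∈ c∈L₂ c∈L₃ y₄∈ y₁≢c y₁≢c , complete₃ (#1 ∷ #0 ∷ #0 ∷ #2 ∷ []) c∉M₁
  ... | yes c∈M₁ with k , k∈ , k∉M₁ ← pick-outside (palette-++ (Disjoint-sym L₁∩L₄=∅) pL₄ pL₁) pM₁ ≤-refl
                 with ∈-++⁻ L₄ k∈
  ...   | inj₁ k∈L₄ with y₁ , y₁∈ , y₁≢c ← avoiding c pL₁ =
    antipawColouring y₁∈ c∈L₂ c∈L₃ k∈L₄ y₁≢c y₁≢c , complete₃ (#2 ∷ #1 ∷ #1 ∷ #0 ∷ []) k∉M₁
  ...   | inj₂ k∈L₁ with y₄ , y₄∈ ← element pL₄ =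
    antipawColouring k∈L₁ c∈L₂ c∈L₃ y₄∈ k≢c k≢c , complete₃ (#0 ∷ #1 ∷ #1 ∷ #2 ∷ []) k∉M₁
    where k≢c = ≢-sym (∈-∉⇒≢ c∈M₁ k∉M₁)

  meet-L₁L₄ : ∀ {d} → Disjoint L₂ L₃ → d ∈ L₁ → d ∈ L₄ → Solution M₁ M₂ M₃ L₁ L₂ L₃ L₄
  meet-L₁L₄ {d} L₂∩L₃=∅ d∈L₁ d∈L₄ with d ∈? M₁
  ... | no d∉M₁ with y₂ , y₂∈ , y₂≢d ← avoiding d pL₂ | y₃ , y₃∈ , y₃≢d ← avoiding d pL₃ =
    antipawColouring d∈L₁ y₂∈ y₃∈ d∈L₄ (≢-sym y₂≢d) (≢-sym y₃≢d) , complete₃ (#0 ∷ #1 ∷ #2 ∷ #0 ∷ []) d∉M₁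
  ... | yes d∈M₁ with k , k∈ , k∉M₁ ← pick-outside (palette-++ L₂∩L₃=∅ pL₂ pL₃) pM₁ ≤-refl
                 with ∈-++⁻ L₂ k∈
  ...   | inj₁ k∈L₂ with y₃ , y₃∈ , y₃≢d ← avoiding d pL₃ =
    antipawColouring d∈L₁ k∈L₂ y₃∈ d∈L₄ d≢k (≢-sym y₃≢d) , complete₃ (#1 ∷ #0 ∷ #2 ∷ #1 ∷ []) k∉M₁
    where d≢k = ∈-∉⇒≢ d∈M₁ k∉M₁
  ...   | inj₂ k∈L₃ with y₂ , y₂∈ , y₂≢d ← avoiding d pL₂ =
    antipawColouring d∈L₁ y₂∈ k∈L₃ d∈L₄ (≢-sym y₂≢d) d≢k , complete₃ (#1 ∷ #2 ∷ #0 ∷ #1 ∷ []) k∉M₁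
    where d≢k = ∈-∉⇒≢ d∈M₁ k∉M₁

  meet-L₂L₄-missing-M₁ : ∀ {d k} → Disjoint L₁ L₄ → d ∈ L₂ → d ∈ L₄ → k ∈ d ∷ L₁ → k ∉ M₁ →
                         Solution M₁ M₂ M₃ L₁ L₂ L₃ L₄
  meet-L₂L₄-missing-M₁ L₁∩L₄=∅ d∈L₂ d∈L₄ (here refl) d∉M₁
    with y₁ , y₁∈ ← element pL₁
    with y₃ , y₃∈ , y₃≢y₁ ← avoiding y₁ pL₃ =
    antipawColouring y₁∈ d∈L₂ y₃∈ d∈L₄ (disjoint⇒≢ L₁∩L₄=∅ y₁∈ d∈L₄) (≢-sym y₃≢y₁) ,
    complete₃ (#1 ∷ #0 ∷ #2 ∷ #0 ∷ []) d∉M₁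
  meet-L₂L₄-missing-M₁ {k = k} L₁∩L₄=∅ d∈L₂ d∈L₄ (there k∈L₁) k∉M₁
    with y₃ , y₃∈ , y₃≢k ← avoiding k pL₃ =
    antipawColouring k∈L₁ d∈L₂ y₃∈ d∈L₄ (disjoint⇒≢ L₁∩L₄=∅ k∈L₁ d∈L₄) (≢-sym y₃≢k) ,
    complete₃ (#0 ∷ #1 ∷ #2 ∷ #1 ∷ []) k∉M₁

  free-y₄-missing-M₁-in-L₂ : ∀ {e k} → e ∈ L₄ → e ∉ M₁ → e ∉ M₂ → k ∈ L₂ → k ∉ M₁ →
                             Solution M₁ M₂ M₃ L₁ L₂ L₃ L₄
  free-y₄-missing-M₁-in-L₂ {k = k} e∈L₄ e∉M₁ e∉M₂ k∈L₂ k∉M₁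
    with y₃ , y₃∈ ← element pL₃
    with y₁ , y₁∈ , y₁≢k , y₁≢y₃ ← avoiding₂ k y₃ pL₁ =
    antipawColouring y₁∈ k∈L₂ y₃∈ e∈L₄ y₁≢k y₁≢y₃ ,
    complete₄ (#2 ∷ #1 ∷ #3 ∷ #0 ∷ []) e∉M₁ k∉M₁ (here e∉M₂)

  apart-y₁y₄-missing-M₁ : ∀ {u k} → Disjoint L₂ L₃ → u ∈ L₁ → u ∉ M₁ → k ∈ L₄ → k ∉ M₁ →
                          Solution M₁ M₂ M₃ L₁ L₂ L₃ L₄
  apart-y₁y₄-missing-M₁ {u} L₂∩L₃=∅ u∈L₁ u∉M₁ k∈L₄ k∉M₁ with u ∈? M₂
  ... | no u∉M₂ with y₂ , y₂∈ , y₂≢u ← avoiding u pL₂ | y₃ , y₃∈ , y₃≢u ← avoiding u pL₃ =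
    antipawColouring u∈L₁ y₂∈ y₃∈ k∈L₄ (≢-sym y₂≢u) (≢-sym y₃≢u) ,
    complete₄ (#0 ∷ #2 ∷ #3 ∷ #1 ∷ []) u∉M₁ k∉M₁ (here u∉M₂)
  ... | yes u∈M₂ with m , m∈ , m∉M₂ ← pick-outside (palette-++ L₂∩L₃=∅ pL₂ pL₃) pM₂ ≤-refl
                 with ∈-++⁻ L₂ m∈
  ...   | inj₁ m∈L₂ with y₃ , y₃∈ , y₃≢u ← avoiding u pL₃ =
    antipawColouring u∈L₁ m∈L₂ y₃∈ k∈L₄ (∈-∉⇒≢ u∈M₂ m∉M₂) (≢-sym y₃≢u) ,
    complete₄ (#0 ∷ #2 ∷ #3 ∷ #1 ∷ []) u∉M₁ k∉M₁ (there (there (here m∉M₂)))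
  ...   | inj₂ m∈L₃ with y₂ , y₂∈ , y₂≢u ← avoiding u pL₂ =
    antipawColouring u∈L₁ y₂∈ m∈L₃ k∈L₄ (≢-sym y₂≢u) (∈-∉⇒≢ u∈M₂ m∉M₂) ,
    complete₄ (#0 ∷ #3 ∷ #2 ∷ #1 ∷ []) u∉M₁ k∉M₁ (there (there (here m∉M₂)))

  apart-y₁y₂-missing-M₁ : ∀ {u k} → Disjoint L₂ L₃ → Disjoint L₂ L₄ → Disjoint L₃ L₄ →
                          u ∈ L₁ → u ∉ M₁ → k ∈ L₂ → k ∉ M₁ → u ≢ k → Solution M₁ M₂ M₃ L₁ L₂ L₃ L₄
  apart-y₁y₂-missing-M₁ {u} {k} L₂∩L₃=∅ L₂∩L₄=∅ L₃∩L₄=∅ u∈L₁ u∉M₁ k∈L₂ k∉M₁ u≢k with u ∈? M₂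
  ... | no u∉M₂ with y₃ , y₃∈ , y₃≢u ← avoiding u pL₃ | y₄ , y₄∈ ← element pL₄ =
    antipawColouring u∈L₁ k∈L₂ y₃∈ y₄∈ u≢k (≢-sym y₃≢u) ,
    complete₄ (#0 ∷ #1 ∷ #2 ∷ #3 ∷ []) u∉M₁ k∉M₁ (here u∉M₂)
  ... | yes u∈M₂ with pick-outside (palette-∷ k∉L₃++L₄ (palette-++ L₃∩L₄=∅ pL₃ pL₄)) pM₂ ≤-refl
    where
    k∉L₃++L₄ : k ∉ L₃ ++ L₄
    k∉L₃++L₄ k∈ =
      [ disjoint⇒∉ (Disjoint-sym L₂∩L₃=∅) k∈L₂ , disjoint⇒∉ (Disjoint-sym L₂∩L₄=∅) k∈L₂ ]′ (∈-++⁻ L₃ k∈)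
  ...   | _ , here refl , k∉M₂ with y₃ , y₃∈ , y₃≢u ← avoiding u pL₃ | y₄ , y₄∈ ← element pL₄ =
    antipawColouring u∈L₁ k∈L₂ y₃∈ y₄∈ u≢k (≢-sym y₃≢u) ,
    complete₄ (#0 ∷ #1 ∷ #2 ∷ #3 ∷ []) u∉M₁ k∉M₁ (there (here k∉M₂))
  ...   | m , there m∈ , m∉M₂ with ∈-++⁻ L₃ m∈
  ...     | inj₁ m∈L₃ with y₄ , y₄∈ ← element pL₄ =
    antipawColouring u∈L₁ k∈L₂ m∈L₃ y₄∈ u≢k (∈-∉⇒≢ u∈M₂ m∉M₂) ,
    complete₄ (#0 ∷ #1 ∷ #2 ∷ #3 ∷ []) u∉M₁ k∉M₁ (there (there (here m∉M₂)))
  ...     | inj₂ m∈L₄ with y₃ , y₃∈ , y₃≢u ← avoiding u pL₃ =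
    antipawColouring u∈L₁ k∈L₂ y₃∈ m∈L₄ u≢k (≢-sym y₃≢u) ,
    complete₄ (#0 ∷ #1 ∷ #2 ∷ #3 ∷ []) u∉M₁ k∉M₁ (there (there (there (here m∉M₂))))

  inside-L₁-two-in-L₂ : ∀ {z₁ z₂ w w′} → M₁ ⊆ z₁ ∷ L₁ → M₂ ⊆ z₂ ∷ L₁ → Disjoint L₁ L₄ → Disjoint L₂ L₄ →
                        w ∈ L₂ → w′ ∈ L₂ → w ≢ w′ → w ∉ L₁ → w′ ∉ L₁ → Solution M₁ M₂ M₃ L₁ L₂ L₃ L₄
  inside-L₁-two-in-L₂ M₁⊆ M₂⊆ L₁∩L₄=∅ L₂∩L₄=∅ w∈ w′∈ w≢w′ w∉L₁ w′∉L₁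
    with a , a∈ ← element pL₄
    with b , b∈ , b≢a ← avoiding a pL₄
    with y₂ , y₂∈ , y₂∉L₁ , y₂∉M₁ ← pick-∉-of-two M₁⊆ w∈ w′∈ w≢w′ w∉L₁ w′∉L₁
    with y₄ , y₄∈ , y₄∉L₁ , y₄∉M₁ ← pick-∉-of-two M₁⊆ a∈ b∈ (≢-sym b≢a)
      (disjoint⇒∉ L₁∩L₄=∅ a∈) (disjoint⇒∉ L₁∩L₄=∅ b∈)
    with y₃ , y₃∈ ← element pL₃
    with y₁ , y₁∈ , y₁≢y₃ ← avoiding y₃ pL₁ =
    antipawColouring y₁∈ y₂∈ y₃∈ y₄∈ (∈-∉⇒≢ y₁∈ y₂∉L₁) y₁≢y₃ ,
    complete₄ (#2 ∷ #0 ∷ #3 ∷ #1 ∷ []) y₂∉M₁ y₄∉M₁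
      ([ here , there ∘ here ]′ (one-of-two-∉ M₂⊆ (disjoint⇒≢ L₂∩L₄=∅ y₂∈ y₄∈) y₂∉L₁ y₄∉L₁))

  inside-L₁-one-in-each : ∀ {z₁ z₂ z₃ w w′} → M₁ ⊆ z₁ ∷ L₁ → M₂ ⊆ z₂ ∷ L₁ → M₃ ⊆ z₃ ∷ L₁ → Disjoint L₁ L₄ →
                          w ∈ L₂ → w′ ∈ L₃ → w ∉ L₁ → w′ ∉ L₁ → Solution M₁ M₂ M₃ L₁ L₂ L₃ L₄
  inside-L₁-one-in-each M₁⊆ M₂⊆ M₃⊆ L₁∩L₄=∅ w∈ w′∈ w∉L₁ w′∉L₁
    with y₁ , y₁∈ ← element pL₁
    with y₄ , y₄∈ ← element pL₄ =
    antipawColouring y₁∈ w∈ w′∈ y₄∈ (∈-∉⇒≢ y₁∈ w∉L₁) (∈-∉⇒≢ y₁∈ w′∉L₁) ,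
    greedy (only-y₁ M₁⊆) (only-y₁ M₂⊆) (only-y₁ M₃⊆) (s≤s (s≤s z≤n)) (s≤s (s≤s z≤n)) (s≤s (s≤s z≤n))
    where
    only-y₁ : ∀ {M z} → M ⊆ z ∷ L₁ → (y₁ ∷ _ ∷ _ ∷ y₄ ∷ []) ∩ M ⊆ (z ∷ y₁ ∷ [])
    only-y₁ M⊆ = (λ _ → #1) ∷ at w∉L₁ ∷ at w′∉L₁ ∷ at (disjoint⇒∉ L₁∩L₄=∅ y₄∈) ∷ []
      where at = λ {v} v∉L₁ v∈M → here (⊆-∷⇒≡ {y = v} M⊆ v∉L₁ v∈M)

module _ {M₁ M₂ M₃ L₁ L₂ L₃ L₄ : List ℕ} (h : Assignment M₁ M₂ M₃ L₁ L₂ L₃ L₄) where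
  open Assignment h

  meet-L₂L₃ : ∀ {c} → c ∈ L₂ → c ∈ L₃ → Solution M₁ M₂ M₃ L₁ L₂ L₃ L₄
  meet-L₂L₃ {c} c∈L₂ c∈L₃ with c ∈? L₄ | common-or-disjoint L₁ L₄
  ... | yes c∈L₄ | _                        = meet-L₂L₃L₄ h c∈L₂ c∈L₃ c∈L₄
  ... | no  c∉L₄ | inj₁ (_ , d∈L₁ , d∈L₄) = meet-L₂L₃-meet-L₁L₄ h c∈L₂ c∈L₃ c∉L₄ d∈L₁ d∈L₄
  ... | no  _    | inj₂ L₁∩L₄=∅            = meet-L₂L₃-apart-L₁L₄ h c∈L₂ c∈L₃ L₁∩L₄=∅

  free-y₄ : ∀ {e} → Disjoint L₂ L₃ → e ∈ L₄ → e ∉ M₁ → e ∉ M₂ → Solution M₁ M₂ M₃ L₁ L₂ L₃ L₄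
  free-y₄ L₂∩L₃=∅ e∈L₄ e∉M₁ e∉M₂
    with k , k∈ , k∉M₁ ← pick-outside (palette-++ L₂∩L₃=∅ pL₂ pL₃) pM₁ ≤-refl
    with ∈-++⁻ L₂ k∈
  ... | inj₁ k∈L₂ = free-y₄-missing-M₁-in-L₂ h e∈L₄ e∉M₁ e∉M₂ k∈L₂ k∉M₁
  ... | inj₂ k∈L₃ =
    solution-swapL₂₃ (free-y₄-missing-M₁-in-L₂ (swapL₂₃ h) e∈L₄ e∉M₁ e∉M₂ k∈L₃ k∉M₁)

  meet-L₂L₄ : ∀ {d} → Disjoint L₁ L₄ → Disjoint L₂ L₃ → d ∈ L₂ → d ∈ L₄ → Solution M₁ M₂ M₃ L₁ L₂ L₃ L₄
  meet-L₂L₄ {d} L₁∩L₄=∅ L₂∩L₃=∅ d∈L₂ d∈L₄ with outside-or-⊆ (d ∷ L₁) M₁ | outside-or-⊆ (d ∷ L₁) M₂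
  ... | inj₁ (_ , k∈ , k∉M₁) | _ = meet-L₂L₄-missing-M₁ h L₁∩L₄=∅ d∈L₂ d∈L₄ k∈ k∉M₁
  ... | inj₂ _ | inj₁ (_ , k∈ , k∉M₂) =
    solution-swapM₁₂ (meet-L₂L₄-missing-M₁ (swapM₁₂ h) L₁∩L₄=∅ d∈L₂ d∈L₄ k∈ k∉M₂)
  ... | inj₂ d∷L₁⊆M₁ | inj₂ d∷L₁⊆M₂ with e , e∈L₄ , e≢d ← avoiding d pL₄ =
    free-y₄ L₂∩L₃=∅ e∈L₄ (e∉ pM₁ d∷L₁⊆M₁) (e∉ pM₂ d∷L₁⊆M₂)
    where
    -- A 5-colour list containing d ∷ L₁ is exactly d ∷ L₁, and e lies outside d ∷ L₁.
    e∉ : ∀ {M} → Palette 5 M → d ∷ L₁ ⊆ M → e ∉ M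
    e∉ pM d∷L₁⊆M e∈M with ⊆⇒⊇ (palette-∷ (disjoint⇒∉ L₁∩L₄=∅ d∈L₄) pL₁) pM d∷L₁⊆M e∈M
    ... | here e≡d  = e≢d e≡d
    ... | there e∈L₁ = disjoint⇒∉ (Disjoint-sym L₁∩L₄=∅) e∈L₁ e∈L₄

  apart-L₄-missing-M₁ : ∀ {u} → Disjoint L₁ L₄ → Disjoint L₂ L₄ → Disjoint L₃ L₄ → Disjoint L₂ L₃ →
                        u ∈ L₁ → u ∉ M₁ → Solution M₁ M₂ M₃ L₁ L₂ L₃ L₄
  apart-L₄-missing-M₁ L₁∩L₄=∅ L₂∩L₄=∅ L₃∩L₄=∅ L₂∩L₃=∅ u∈L₁ u∉M₁
    with k , k∈ , k∉u∷M₁ ← pick-outside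
           (palette-++ (disjoint-++⁺ (Disjoint-sym L₂∩L₄=∅) (Disjoint-sym L₃∩L₄=∅)) pL₄ (palette-++ L₂∩L₃=∅ pL₂ pL₃))
           (palette-∷ u∉M₁ pM₁) (m≤n⇒m≤1+n ≤-refl)
    with ∈-++⁻ L₄ k∈
  ... | inj₁ k∈L₄ = apart-y₁y₄-missing-M₁ h L₂∩L₃=∅ u∈L₁ u∉M₁ k∈L₄ (k∉u∷M₁ ∘ there)
  ... | inj₂ k∈L₂₃ with ∈-++⁻ L₂ k∈L₂₃
  ...   | inj₁ k∈L₂ =
    apart-y₁y₂-missing-M₁ h L₂∩L₃=∅ L₂∩L₄=∅ L₃∩L₄=∅ u∈L₁ u∉M₁ k∈L₂ (k∉u∷M₁ ∘ there) u≢k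
    where u≢k = ≢-sym (k∉u∷M₁ ∘ here)
  ...   | inj₂ k∈L₃ = solution-swapL₂₃
    (apart-y₁y₂-missing-M₁ (swapL₂₃ h) (Disjoint-sym L₂∩L₃=∅) L₃∩L₄=∅ L₂∩L₄=∅
      u∈L₁ u∉M₁ k∈L₃ (k∉u∷M₁ ∘ there) u≢k)
    where u≢k = ≢-sym (k∉u∷M₁ ∘ here)

  -- Each Mᵢ is then L₁ plus one colour zᵢ, so colours outside L₁ meet each Mᵢ at most once.
  inside-L₁ : Disjoint L₁ L₄ → Disjoint L₂ L₄ → Disjoint L₃ L₄ → Disjoint L₂ L₃ →
              L₁ ⊆ M₁ → L₁ ⊆ M₂ → L₁ ⊆ M₃ → Solution M₁ M₂ M₃ L₁ L₂ L₃ L₄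
  inside-L₁ L₁∩L₄=∅ L₂∩L₄=∅ L₃∩L₄=∅ L₂∩L₃=∅ L₁⊆M₁ L₁⊆M₂ L₁⊆M₃
    with z₁ , M₁⊆ ← ⊆⇒⊆-∷ pL₁ pM₁ L₁⊆M₁
    with z₂ , M₂⊆ ← ⊆⇒⊆-∷ pL₁ pM₂ L₁⊆M₂
    with z₃ , M₃⊆ ← ⊆⇒⊆-∷ pL₁ pM₃ L₁⊆M₃
    with w , w∈ , w∉L₁ ← pick-outside (palette-++ L₂∩L₃=∅ pL₂ pL₃) pL₁ (m≤n⇒m≤1+n ≤-refl)
    with w′ , w′∈ , w′∉w∷L₁ ← pick-outside (palette-++ L₂∩L₃=∅ pL₂ pL₃) (palette-∷ w∉L₁ pL₁) ≤-refl
    with ∈-++⁻ L₂ w∈ | ∈-++⁻ L₂ w′∈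
  ... | inj₁ w∈L₂ | inj₁ w′∈L₂ =
    inside-L₁-two-in-L₂ h M₁⊆ M₂⊆ L₁∩L₄=∅ L₂∩L₄=∅ w∈L₂ w′∈L₂ w≢w′ w∉L₁ (w′∉w∷L₁ ∘ there)
    where w≢w′ = ≢-sym (w′∉w∷L₁ ∘ here)
  ... | inj₁ w∈L₂ | inj₂ w′∈L₃ =
    inside-L₁-one-in-each h M₁⊆ M₂⊆ M₃⊆ L₁∩L₄=∅ w∈L₂ w′∈L₃ w∉L₁ (w′∉w∷L₁ ∘ there)
  ... | inj₂ w∈L₃ | inj₁ w′∈L₂ =
    inside-L₁-one-in-each h M₁⊆ M₂⊆ M₃⊆ L₁∩L₄=∅ w′∈L₂ w∈L₃ (w′∉w∷L₁ ∘ there) w∉L₁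
  ... | inj₂ w∈L₃ | inj₂ w′∈L₃ = solution-swapL₂₃
    (inside-L₁-two-in-L₂ (swapL₂₃ h) M₁⊆ M₂⊆ L₁∩L₄=∅ L₃∩L₄=∅ w∈L₃ w′∈L₃ w≢w′ w∉L₁ (w′∉w∷L₁ ∘ there))
    where w≢w′ = ≢-sym (w′∉w∷L₁ ∘ here)

module _ {M₁ M₂ M₃ L₁ L₂ L₃ L₄ : List ℕ} (h : Assignment M₁ M₂ M₃ L₁ L₂ L₃ L₄) where

  apart-L₄ : Disjoint L₁ L₄ → Disjoint L₂ L₄ → Disjoint L₃ L₄ → Disjoint L₂ L₃ → Solution M₁ M₂ M₃ L₁ L₂ L₃ L₄
  apart-L₄ L₁∩L₄=∅ L₂∩L₄=∅ L₃∩L₄=∅ L₂∩L₃=∅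
    with outside-or-⊆ L₁ M₁ | outside-or-⊆ L₁ M₂ | outside-or-⊆ L₁ M₃
  ... | inj₁ (_ , u∈L₁ , u∉M₁) | _ | _ =
    apart-L₄-missing-M₁ h L₁∩L₄=∅ L₂∩L₄=∅ L₃∩L₄=∅ L₂∩L₃=∅ u∈L₁ u∉M₁
  ... | inj₂ _ | inj₁ (_ , u∈L₁ , u∉M₂) | _ = solution-swapM₁₂
    (apart-L₄-missing-M₁ (swapM₁₂ h) L₁∩L₄=∅ L₂∩L₄=∅ L₃∩L₄=∅ L₂∩L₃=∅ u∈L₁ u∉M₂)
  ... | inj₂ _ | inj₂ _ | inj₁ (_ , u∈L₁ , u∉M₃) = solution-swapM₂₃ (solution-swapM₁₂
    (apart-L₄-missing-M₁ (swapM₁₂ (swapM₂₃ h)) L₁∩L₄=∅ L₂∩L₄=∅ L₃∩L₄=∅ L₂∩L₃=∅ u∈L₁ u∉M₃))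
  ... | inj₂ L₁⊆M₁ | inj₂ L₁⊆M₂ | inj₂ L₁⊆M₃ =
    inside-L₁ h L₁∩L₄=∅ L₂∩L₄=∅ L₃∩L₄=∅ L₂∩L₃=∅ L₁⊆M₁ L₁⊆M₂ L₁⊆M₃

  solve : Solution M₁ M₂ M₃ L₁ L₂ L₃ L₄
  solve with common-or-disjoint L₂ L₃
  ... | inj₁ (_ , c∈L₂ , c∈L₃) = meet-L₂L₃ h c∈L₂ c∈L₃
  ... | inj₂ L₂∩L₃=∅ with common-or-disjoint L₁ L₄
  ...   | inj₁ (_ , d∈L₁ , d∈L₄) = meet-L₁L₄ h L₂∩L₃=∅ d∈L₁ d∈L₄
  ...   | inj₂ L₁∩L₄=∅ with common-or-disjoint L₂ L₄ | common-or-disjoint L₃ L₄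
  ...     | inj₁ (_ , d∈L₂ , d∈L₄) | _ = meet-L₂L₄ h L₁∩L₄=∅ L₂∩L₃=∅ d∈L₂ d∈L₄
  ...     | inj₂ _ | inj₁ (_ , d∈L₃ , d∈L₄) =
    solution-swapL₂₃ (meet-L₂L₄ (swapL₂₃ h) L₁∩L₄=∅ (Disjoint-sym L₂∩L₃=∅) d∈L₃ d∈L₄)
  ...     | inj₂ L₂∩L₄=∅ | inj₂ L₃∩L₄=∅ = apart-L₄ L₁∩L₄=∅ L₂∩L₄=∅ L₃∩L₄=∅ L₂∩L₃=∅

Proper : ∀ {n} → Graph n → (Fin n → ℕ) → Set
Proper G c = ∀ u v → adj G u v ≡ true → c u ≢ c v

join-colourable : ∀ {m k} (A : Graph m) (B : Graph k) (L : Fin (m + k) → List ℕ) {cA : Fin m → ℕ} {cB : Fin k → ℕ} →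
                  (∀ a → cA a ∈ L (a ↑ˡ k)) → (∀ b → cB b ∈ L (m ↑ʳ b)) →
                  Proper A cA → Proper B cB → (∀ a b → cA a ≢ cB b) → Colorable (A ∨ᴳ B) L
join-colourable {m} {k} A B L {cA} {cB} cA∈ cB∈ properA properB apart = c , c∈ , proper
  where
  c : Fin (m + k) → ℕ
  c x = [ cA , cB ]′ (splitAt m x)
  c∈ : ∀ x → c x ∈ L x
  c∈ x with splitAt m x in eq
  ... | inj₁ a = subst (λ y → cA a ∈ L y) (splitAt⁻¹-↑ˡ eq) (cA∈ a)
  ... | inj₂ b = subst (λ y → cB b ∈ L y) (splitAt⁻¹-↑ʳ eq) (cB∈ b)
  proper : Proper (A ∨ᴳ B) c
  proper u v with splitAt m u | splitAt m v
  ... | inj₁ a | inj₁ a′ = properA a a′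
  ... | inj₂ b | inj₂ b′ = properB b b′
  ... | inj₁ a | inj₂ b  = λ _ → apart a b
  ... | inj₂ b | inj₁ a  = λ _ → ≢-sym (apart a b)

colourable : (L : Fin 7 → List ℕ) → Solution (L 0F) (L 1F) (L 2F) (L 3F) (L 4F) (L 5F) (L 6F) →
             Colorable (K 3 ∨ᴳ antipaw) L
colourable L (ys , xs) = join-colourable (K 3) antipaw L x∈ y∈ properK properAntipaw apart
  where
  open TriangleColouring xs
  open AntipawColouring ys

  x : Fin 3 → ℕ
  x 0F = x₁
  x 1F = x₂
  x 2F = x₃

  y : Fin 4 → ℕ
  y 0F = y₁
  y 1F = y₂
  y 2F = y₃
  y 3F = y₄

  x∈ : ∀ a → x a ∈ L (a ↑ˡ 4)
  x∈ 0F = x₁∈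
  x∈ 1F = x₂∈
  x∈ 2F = x₃∈

  y∈ : ∀ b → y b ∈ L (3 ↑ʳ b)
  y∈ 0F = y₁∈
  y∈ 1F = y₂∈
  y∈ 2F = y₃∈
  y∈ 3F = y₄∈

  properK : Proper (K 3) x
  properK 0F 0F ()
  properK 0F 1F _ = x₁≢x₂
  properK 0F 2F _ = x₁≢x₃
  properK 1F 0F _ = ≢-sym x₁≢x₂
  properK 1F 1F ()
  properK 1F 2F _ = x₂≢x₃
  properK 2F 0F _ = ≢-sym x₁≢x₃
  properK 2F 1F _ = ≢-sym x₂≢x₃
  properK 2F 2F ()

  properAntipaw : Proper antipaw y
  properAntipaw 0F 1F _ = y₁≢y₂
  properAntipaw 0F 2F _ = y₁≢y₃
  properAntipaw 1F 0F _ = ≢-sym y₁≢y₂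
  properAntipaw 2F 0F _ = ≢-sym y₁≢y₃
  properAntipaw 0F 0F ()
  properAntipaw 0F 3F ()
  properAntipaw 1F 1F ()
  properAntipaw 1F 2F ()
  properAntipaw 1F 3F ()
  properAntipaw 2F 1F ()
  properAntipaw 2F 2F ()
  properAntipaw 2F 3F ()
  properAntipaw 3F 0F ()
  properAntipaw 3F 1F ()
  properAntipaw 3F 2F ()
  properAntipaw 3F 3F ()

  x∉ : ∀ a → x a ∉ colours
  x∉ 0F = x₁∉
  x∉ 1F = x₂∉
  x∉ 2F = x₃∉

  y∈colours : ∀ b → y b ∈ colours
  y∈colours 0F = #0
  y∈colours 1F = #1
  y∈colours 2F = #2
  y∈colours 3F = #3

  apart : ∀ a b → x a ≢ y b
  apart a b xa≡yb = x∉ a (subst (_∈ colours) (sym xa≡yb) (y∈colours b))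

mainTheorem16 : D1Choosable (K 3 ∨ᴳ antipaw)
mainTheorem16 L = colourable (lists L) (solve (assignment (palette 0F) (palette 1F) (palette 2F)
                                                          (palette 3F) (palette 4F) (palette 5F) (palette 6F)))
  where
  palette : ∀ v → Palette (deg (K 3 ∨ᴳ antipaw) v ∸ 1) (lists L v)
  palette v = record { distinct = unique L v ; size = size L v }
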